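{- Let $l\ge5$ and $k$ be integers. Assume that $k\ge1$ if $l$ is prime, and that $k>\sqrt{p^2+l^2/p^2}$ otherwise, where $p$ is the smallest prime divisor of $l$. If $k\le l^2/2$, then $m_0(1+kx,l)=1$.
   Context: $\|f\|$ is the sum of squares of the coefficients of $f\in\mathbb{Z}[x]$, and $f|_m$ is the remainder of $f$ upon division by $x^m$. For $c,d\in\mathbb{Z}[x]$ with $c(0),d(0)\neq0$, $m_0(c,d)$ denotes the smallest nonnegative integer $m_0$ such that for every $m>m_0$ and all $a,b\in\mathbb{Z}[x]$ with $\deg a,\deg b<m$ and $(ab)|_m=cd$, one has $ab=cd$ or $\|a\|+\|b\|>\|c\|+\|d\|$. Here $c=1+kx$ and $d$ is the constant polynomial $l$. -}

module Defs where

open import Data.Nat as ℕ using (ℕ; zero; suc; _<_)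
open import Data.Integer as ℤ using (ℤ; +_; 0ℤ)
open import Data.List using (List; []; _∷_; map; take; foldr)
open import Data.Vec using (Vec; toList)
open import Data.Sum using (_⊎_)
open import Data.Product using (_×_)
open import Relation.Binary.PropositionalEquality using (_≡_)
open import Relation.Nullary using (¬_)

-- Polynomials in ℤ[x] as coefficient lists, lowest degree first.
-- Trailing zeros are allowed; equality of polynomials is coefficientwise.
Poly : Set
Poly = List ℤ

coeff : Poly → ℕ → ℤ
coeff []       _       = 0ℤ
coeff (a ∷ p)  zero    = a
coeff (a ∷ p)  (suc n) = coeff p n

_+ₚ_ : Poly → Poly → Poly
[]      +ₚ q       = q
(a ∷ p) +ₚ []      = a ∷ p
(a ∷ p) +ₚ (b ∷ q) = (a ℤ.+ b) ∷ (p +ₚ q)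

_*ₚ_ : Poly → Poly → Poly
[]      *ₚ q = []
(a ∷ p) *ₚ q = map (a ℤ.*_) q +ₚ (0ℤ ∷ (p *ₚ q))

_≈ₚ_ : Poly → Poly → Set
p ≈ₚ q = ∀ n → coeff p n ≡ coeff q n

-- f|_m : remainder of f upon division by x^m
trunc : ℕ → Poly → Poly
trunc m p = take m p

norm : Poly → ℤ
norm p = foldr (λ x s → x ℤ.* x ℤ.+ s) 0ℤ p

-- The defining property of m_0 at a fixed m: for all a, b of degree < m
-- (vectors of m coefficients) with (ab)|_m = (cd)|_m, either ab = cd or
-- ‖a‖ + ‖b‖ > ‖c‖ + ‖d‖.
GoodAt : Poly → Poly → ℕ → Set
GoodAt c d m =
  (a b : Vec ℤ m) →
  trunc m (toList a *ₚ toList b) ≈ₚ trunc m (c *ₚ d) →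
  ((toList a *ₚ toList b) ≈ₚ (c *ₚ d)) ⊎ (norm c ℤ.+ norm d ℤ.< norm (toList a) ℤ.+ norm (toList b))

Threshold : Poly → Poly → ℕ → Set
Threshold c d m₀ = ∀ m → m₀ < m → GoodAt c d m

IsM0 : Poly → Poly → ℕ → Set
IsM0 c d m₀ = Threshold c d m₀ × (∀ n → n < m₀ → ¬ Threshold c d n)

module Submission where

-- Let m ≥ 2 and a = a₀ + a₁x + x²A, b = b₀ + b₁x + x²B with (ab)|ₘ = (cd)|ₘ.  Comparing
-- the coefficients of 1 and x gives a₀b₀ = l and a₀b₁ + a₁b₀ = kl.  We show that the
-- contribution Q = a₀² + a₁² + b₀² + b₁² of the low coefficients to ‖a‖ + ‖b‖ exceeds
-- N = ‖c‖ + ‖d‖ = 1 + k² + l², or equals it with a₁b₁ = 0; adding the tails then gives either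
-- ‖a‖ + ‖b‖ > N or A = B = 0 and ab = cd.
--  * Unit case a₀ = ±1 (or b₀ = ±1, by the symmetries a ↔ b and (a, b) ↦ (−a, −b)): then b₀ = ±l
--    and, with t = k − a₁, Q − N = t² + (l² − 2k)t² + 2k·t(t − 1) ≥ t², which vanishes only if
--    a₁ = k and b₁ = 0.
--  * Non-unit case |a₀|, |b₀| ≥ 2: then l = |a₀||b₀| is composite, s = a₀² + b₀² < k² (as
--    p ≤ |a₀|, |b₀|) and 2s < l², and Cauchy–Schwarz g·s ≥ k²l² for g = a₁² + b₁² forces
--    g + s > 1 + k² + l².
-- Finally m = 1 is not a threshold: a = 1, b = l gives ab ≠ cd with ‖a‖ + ‖b‖ ≤ ‖c‖ + ‖d‖.

open import Defs

module IntegerOrder where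

  open import Data.Nat as ℕ using (zero; suc; z≤n; s≤s)
  open import Data.Integer using (+_; -[1+_]; 0ℤ; ∣_∣; _+_; _*_; _-_; _≤_; _<_; +≤+; +<+)
  import Data.Integer.Properties as ℤP
  open import Data.Empty using (⊥-elim)
  open import Relation.Binary.PropositionalEquality
  open import Relation.Nullary using (¬_)

  pos-nonneg : ∀ n → 0ℤ ≤ + n
  pos-nonneg n = +≤+ z≤n

  nonneg-+ : ∀ {i j} → 0ℤ ≤ i → 0ℤ ≤ j → 0ℤ ≤ i + j
  nonneg-+ = ℤP.+-mono-≤

  nonneg-* : ∀ {i j} → 0ℤ ≤ i → 0ℤ ≤ j → 0ℤ ≤ i * j
  nonneg-* {+ m} {+ n} _ _ = subst (0ℤ ≤_) (ℤP.pos-* m n) (+≤+ z≤n)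

  ≤-+-nonneg : ∀ i {j} → 0ℤ ≤ j → i ≤ i + j
  ≤-+-nonneg i 0≤j = subst (_≤ i + _) (ℤP.+-identityʳ i) (ℤP.+-monoʳ-≤ i 0≤j)

  <-+-pos : ∀ i {j} → 0ℤ < j → i < i + j
  <-+-pos i 0<j = subst (_< i + _) (ℤP.+-identityʳ i) (ℤP.+-monoʳ-< i 0<j)

  square≡abs² : ∀ x → x * x ≡ + (∣ x ∣ ℕ.* ∣ x ∣)
  square≡abs² (+ n)    = sym (ℤP.pos-* n n)
  square≡abs² -[1+ n ] = refl

  sum-of-squares : ∀ x y → x * x + y * y ≡ + (∣ x ∣ ℕ.* ∣ x ∣ ℕ.+ ∣ y ∣ ℕ.* ∣ y ∣)
  sum-of-squares x y = cong₂ _+_ (square≡abs² x) (square≡abs² y)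

  square-nonneg : ∀ x → 0ℤ ≤ x * x
  square-nonneg x = subst (0ℤ ≤_) (sym (square≡abs² x)) (+≤+ z≤n)

  square-pos : ∀ x → ¬ x ≡ 0ℤ → 0ℤ < x * x
  square-pos (+ zero)   x≢0 = ⊥-elim (x≢0 refl)
  square-pos (+ suc n)  _   = +<+ (s≤s z≤n)
  square-pos -[1+ n ]   _   = +<+ (s≤s z≤n)

  -- Consecutive integers never have strictly opposite signs.
  consecutive-product-nonneg : ∀ t → 0ℤ ≤ t * (t - + 1)
  consecutive-product-nonneg (+ zero)  = +≤+ z≤n
  consecutive-product-nonneg (+ suc n) = subst (0ℤ ≤_) (ℤP.pos-* (suc n) n) (+≤+ z≤n)
  consecutive-product-nonneg -[1+ n ]  = +≤+ z≤n

module Polynomials where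

  open import Data.Nat using (zero; suc)
  open import Data.Integer using (+_; -[1+_]; 0ℤ; _+_; _*_; _≤_; _<_)
  import Data.Integer.Properties as ℤP
  open import Data.List using ([]; _∷_; map)
  open import Data.Product using (_×_; _,_)
  open import Data.Sum using (_⊎_; inj₁; inj₂)
  open import Relation.Binary.PropositionalEquality
  open IntegerOrder

  IsZero : Poly → Set
  IsZero p = ∀ n → coeff p n ≡ 0ℤ

  coeff-+ₚ : ∀ p q n → coeff (p +ₚ q) n ≡ coeff p n + coeff q n
  coeff-+ₚ []      q       n       = sym (ℤP.+-identityˡ _)
  coeff-+ₚ (a ∷ p) []      n       = sym (ℤP.+-identityʳ _)
  coeff-+ₚ (a ∷ p) (b ∷ q) zero    = refl
  coeff-+ₚ (a ∷ p) (b ∷ q) (suc n) = coeff-+ₚ p q n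

  coeff-scale : ∀ a q n → coeff (map (a *_) q) n ≡ a * coeff q n
  coeff-scale a []      n       = sym (ℤP.*-zeroʳ a)
  coeff-scale a (b ∷ q) zero    = refl
  coeff-scale a (b ∷ q) (suc n) = coeff-scale a q n

  coeff-*ₚ-zero : ∀ x p q → coeff ((x ∷ p) *ₚ q) 0 ≡ x * coeff q 0
  coeff-*ₚ-zero x p q =
    trans (coeff-+ₚ (map (x *_) q) (0ℤ ∷ (p *ₚ q)) 0)
          (trans (ℤP.+-identityʳ _) (coeff-scale x q 0))

  coeff-*ₚ-suc : ∀ x p q n →
    coeff ((x ∷ p) *ₚ q) (suc n) ≡ x * coeff q (suc n) + coeff (p *ₚ q) n
  coeff-*ₚ-suc x p q n =
    trans (coeff-+ₚ (map (x *_) q) (0ℤ ∷ (p *ₚ q)) (suc n))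
          (cong (_+ coeff (p *ₚ q) n) (coeff-scale x q (suc n)))

  *ₚ-zeroˡ : ∀ p q → IsZero p → IsZero (p *ₚ q)
  *ₚ-zeroˡ []      q p≡0 n       = refl
  *ₚ-zeroˡ (x ∷ p) q p≡0 zero    =
    trans (coeff-*ₚ-zero x p q) (trans (cong (_* coeff q 0) (p≡0 0)) (ℤP.*-zeroˡ (coeff q 0)))
  *ₚ-zeroˡ (x ∷ p) q p≡0 (suc n) = begin
    coeff ((x ∷ p) *ₚ q) (suc n)              ≡⟨ coeff-*ₚ-suc x p q n ⟩
    x * coeff q (suc n) + coeff (p *ₚ q) n    ≡⟨ cong₂ _+_ (cong (_* coeff q (suc n)) (p≡0 0))
                                                            (*ₚ-zeroˡ p q (λ i → p≡0 (suc i)) n) ⟩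
    0ℤ * coeff q (suc n) + 0ℤ                 ≡⟨ cong (_+ 0ℤ) (ℤP.*-zeroˡ (coeff q (suc n))) ⟩
    0ℤ                                        ∎
    where open ≡-Reasoning

  coeff-beyond-linear : ∀ a0 a1 A b0 b1 B → IsZero A → IsZero B → ∀ j →
    coeff ((a0 ∷ a1 ∷ A) *ₚ (b0 ∷ b1 ∷ B)) (suc (suc j)) ≡ coeff (a1 * b1 ∷ []) j
  coeff-beyond-linear a0 a1 A b0 b1 B A≡0 B≡0 j = begin
    coeff ((a0 ∷ a1 ∷ A) *ₚ b) (suc (suc j))                    ≡⟨ coeff-*ₚ-suc a0 (a1 ∷ A) b (suc j) ⟩
    a0 * coeff B j + coeff ((a1 ∷ A) *ₚ b) (suc j)              ≡⟨ cong₂ _+_ (cong (a0 *_) (B≡0 j))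
                                                                          (coeff-*ₚ-suc a1 A b j) ⟩
    a0 * 0ℤ + (a1 * coeff (b1 ∷ B) j + coeff (A *ₚ b) j)        ≡⟨ cong₂ (λ z w → z + (a1 * coeff (b1 ∷ B) j + w))
                                                                          (ℤP.*-zeroʳ a0) (*ₚ-zeroˡ A b A≡0 j) ⟩
    0ℤ + (a1 * coeff (b1 ∷ B) j + 0ℤ)                           ≡⟨ trans (ℤP.+-identityˡ _) (ℤP.+-identityʳ _) ⟩
    a1 * coeff (b1 ∷ B) j                                       ≡⟨ tail-term j ⟩
    coeff (a1 * b1 ∷ []) j                                      ∎
    where
    open ≡-Reasoning
    b = b0 ∷ b1 ∷ B
    tail-term : ∀ j → a1 * coeff (b1 ∷ B) j ≡ coeff (a1 * b1 ∷ []) j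
    tail-term zero    = refl
    tail-term (suc j) = trans (cong (a1 *_) (B≡0 j)) (ℤP.*-zeroʳ a1)

  norm-nonneg : ∀ p → 0ℤ ≤ norm p
  norm-nonneg []      = pos-nonneg 0
  norm-nonneg (x ∷ p) = nonneg-+ (square-nonneg x) (norm-nonneg p)

  zero-or-norm-pos : ∀ p → IsZero p ⊎ 0ℤ < norm p
  zero-or-norm-pos []             = inj₁ (λ _ → refl)
  zero-or-norm-pos (+ zero ∷ p) with zero-or-norm-pos p
  ... | inj₁ p≡0 = inj₁ λ { zero → refl ; (suc n) → p≡0 n }
  ... | inj₂ pos = inj₂ (subst (0ℤ <_) (sym (ℤP.+-identityˡ (norm p))) pos)
  zero-or-norm-pos (x@(+ suc _) ∷ p) =
    inj₂ (ℤP.<-≤-trans (square-pos x λ ()) (≤-+-nonneg (x * x) (norm-nonneg p)))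
  zero-or-norm-pos (x@(-[1+ _ ]) ∷ p) =
    inj₂ (ℤP.<-≤-trans (square-pos x λ ()) (≤-+-nonneg (x * x) (norm-nonneg p)))

  tails-zero-or-pos : ∀ A B → (IsZero A × IsZero B) ⊎ 0ℤ < norm A + norm B
  tails-zero-or-pos A B with zero-or-norm-pos A | zero-or-norm-pos B
  ... | inj₁ A≡0 | inj₁ B≡0 = inj₁ (A≡0 , B≡0)
  ... | inj₂ posA | _        = inj₂ (ℤP.<-≤-trans posA (≤-+-nonneg (norm A) (norm-nonneg B)))
  ... | inj₁ _   | inj₂ posB =
    inj₂ (ℤP.<-≤-trans posB (subst (norm B ≤_) (ℤP.+-comm (norm B) (norm A))
                                    (≤-+-nonneg (norm B) (norm-nonneg A))))

module NatInequalities where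

  open import Data.Nat using (suc; z≤n; s≤s; _≤_; _<_; _+_; _*_)
  open import Data.Nat.Properties
  open import Data.Product using (_,_)
  open import Relation.Binary.PropositionalEquality
  open import Relation.Nullary using (yes; no)
  open import Data.Empty using (⊥-elim)
  import Data.Nat.Tactic.RingSolver as ℕSolver

  -- (u² − p²)(v² − p²) ≥ 0 for p ≤ u, v, rearranged.
  square-sum-bound : ∀ {p u v} → p ≤ u → p ≤ v →
    p * p * (u * u + v * v) ≤ (u * v) * (u * v) + p * p * p * p
  square-sum-bound {p} p≤u p≤v with m≤n⇒∃[o]m+o≡n p≤u | m≤n⇒∃[o]m+o≡n p≤v
  ... | U , refl | V , refl = ≤-trans (m≤m+n _ _) (≤-reflexive (sym (expand p U V)))
    where
    expand : ∀ p U V →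
      ((p + U) * (p + V)) * ((p + U) * (p + V)) + p * p * p * p
        ≡ p * p * ((p + U) * (p + U) + (p + V) * (p + V))
          + U * V * ((p + U) * (p + V) + p * p + p * ((p + U) + (p + V)))
    expand = ℕSolver.solve-∀

  -- (uv)² − 2(u² + v²) = (u² − 2)(v² − 2) − 4 is positive once u ≥ 3 and v ≥ 2.
  twice-square-sum<′ : ∀ {u v} → 3 ≤ u → 2 ≤ v → 2 * (u * u + v * v) < (u * v) * (u * v)
  twice-square-sum<′ 3≤u 2≤v with m≤n⇒∃[o]m+o≡n 3≤u | m≤n⇒∃[o]m+o≡n 2≤v
  ... | U , refl | V , refl = ≤-trans (m≤m+n _ _) (≤-reflexive (sym (expand U V)))
    where
    expand : ∀ U V →
      ((3 + U) * (2 + V)) * ((3 + U) * (2 + V))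
        ≡ suc (2 * ((3 + U) * (3 + U) + (2 + V) * (2 + V)))
          + (9 + 28 * V + 7 * V * V + 12 * U + 24 * U * V + 6 * U * V * V
             + 2 * U * U + 4 * U * U * V + U * U * V * V)
    expand = ℕSolver.solve-∀

  -- The same for every factorisation l = uv ≥ 5 with u, v ≥ 2 (l ≥ 5 excludes u = v = 2).
  twice-square-sum< : ∀ {u v} → 2 ≤ u → 2 ≤ v → 5 ≤ u * v →
    2 * (u * u + v * v) < (u * v) * (u * v)
  twice-square-sum< {u} {v} 2≤u 2≤v 5≤uv with 3 ≤? u | 3 ≤? v
  ... | yes 3≤u | _       = twice-square-sum<′ 3≤u 2≤v
  ... | no _    | yes 3≤v =
    subst₂ (λ s w → 2 * s < w * w) (+-comm (v * v) (u * u)) (*-comm v u)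
           (twice-square-sum<′ 3≤v 2≤u)
  ... | no u≱3  | no v≱3  =
    ⊥-elim (≤⇒≯ (*-mono-≤ (≤-pred (≰⇒> u≱3)) (≤-pred (≰⇒> v≱3))) 5≤uv)

  -- If g·s ≥ K₂L₂ with s < K₂ and 2s < L₂, then g + s > 1 + K₂ + L₂: indeed
  -- (1 + K₂ + L₂)s < K₂L₂ + s² ≤ (g + s)s, as (K₂ − s)(L₂ − s) > s.
  tradeoff : ∀ {s K₂ L₂} g → s < K₂ → 2 * s < L₂ → K₂ * L₂ ≤ g * s → 1 + K₂ + L₂ < g + s
  tradeoff {s} g s<K₂ 2s<L₂ K₂L₂≤gs with m≤n⇒∃[o]m+o≡n s<K₂ | m≤n⇒∃[o]m+o≡n 2s<L₂
  ... | d₁ , refl | d₂ , refl = *-cancelʳ-< s _ _ (begin-strict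
    (1 + K₂ + L₂) * s                                      <⟨ m<m+n _ (s≤s z≤n) ⟩
    (1 + K₂ + L₂) * s + suc (d₁ + d₂ + d₁ * s + d₁ * d₂)   ≡⟨ expand s d₁ d₂ ⟩
    K₂ * L₂ + s * s                                        ≤⟨ +-monoˡ-≤ (s * s) K₂L₂≤gs ⟩
    g * s + s * s                                          ≡⟨ *-distribʳ-+ s g s ⟨
    (g + s) * s                                            ∎)
    where
    K₂ = suc s + d₁
    L₂ = suc (2 * s) + d₂
    open ≤-Reasoning
    expand : ∀ s d₁ d₂ →
      (1 + (suc s + d₁) + (suc (2 * s) + d₂)) * s + suc (d₁ + d₂ + d₁ * s + d₁ * d₂)
        ≡ (suc s + d₁) * (suc (2 * s) + d₂) + s * s
    expand = ℕSolver.solve-∀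

  factored-bound : ∀ {K l p u v} g → u * v ≡ l → 2 ≤ u → 2 ≤ v → 5 ≤ l → p ≤ u → p ≤ v →
    p * p * p * p + l * l < K * K * (p * p) → (K * l) * (K * l) ≤ g * (u * u + v * v) →
    1 + K * K + l * l < g + (u * u + v * v)
  factored-bound {K} {p = p} {u} {v} g refl 2≤u 2≤v 5≤l p≤u p≤v bound cs =
    tradeoff g s<K² (twice-square-sum< 2≤u 2≤v 5≤l)
             (subst (_≤ g * s) (regroup K (u * v)) cs)
    where
    s = u * u + v * v
    regroup : ∀ K l → (K * l) * (K * l) ≡ K * K * (l * l)
    regroup = ℕSolver.solve-∀
    s<K² : s < K * K
    s<K² = *-cancelˡ-< (p * p) s (K * K) (begin-strict
      p * p * s                              ≤⟨ square-sum-bound p≤u p≤v ⟩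
      (u * v) * (u * v) + p * p * p * p      ≡⟨ +-comm _ (p * p * p * p) ⟩
      p * p * p * p + (u * v) * (u * v)      <⟨ bound ⟩
      K * K * (p * p)                        ≡⟨ *-comm (K * K) (p * p) ⟩
      p * p * (K * K)                        ∎)
      where open ≤-Reasoning

module LeastFactors where

  open import Data.Nat using (ℕ; zero; suc; _+_; _∸_; _≤_; _<_; n>1⇒nonTrivial; nonTrivial⇒n>1)
  open import Data.Nat.Properties using (≤-refl; ≮⇒≥; m≤n⇒m≤1+n; +-identityʳ; +-suc; m+[n∸m]≡n)
  open import Data.Nat.Divisibility using (_∣_; _∣?_; ∣-refl)
  open import Data.Nat.Divisibility.Core using (hasNonTrivialDivisor)
  open import Data.Nat.Primality
    using (Prime; _Rough_; 2-rough; ∤⇒rough-suc; rough∧∣⇒prime; prime⇒nonTrivial; composite⇒¬prime)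
  open import Relation.Binary.PropositionalEquality
  open import Relation.Nullary using (¬_; yes; no)

  record LeastFactor (n : ℕ) : Set where
    field
      factor   : ℕ
      2≤factor : 2 ≤ factor
      rough    : factor Rough n
      factor∣n : factor ∣ n

    below : ∀ {d} → 2 ≤ d → d ∣ n → factor ≤ d
    below 2≤d d∣n = ≮⇒≥ λ d<factor →
      rough (hasNonTrivialDivisor {{n>1⇒nonTrivial 2≤d}} d<factor d∣n)

    prime : Prime factor
    prime = rough∧∣⇒prime {{n>1⇒nonTrivial 2≤factor}} rough factor∣n

    minimal : ∀ q → Prime q → q ∣ n → factor ≤ q
    minimal q q-prime q∣n = below (nonTrivial⇒n>1 q {{prime⇒nonTrivial q-prime}}) q∣n

  -- Linear search upwards from an n-rough candidate m ≥ 2 with m + gap = n; every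
  -- non-divisor m makes suc m rough, and at the latest m = n divides n.
  search : ∀ {n} m gap → m + gap ≡ n → 2 ≤ m → m Rough n → LeastFactor n
  search m zero m+0≡n 2≤m rough =
    record { factor = m ; 2≤factor = 2≤m ; rough = rough
           ; factor∣n = subst (m ∣_) (trans (sym (+-identityʳ m)) m+0≡n) ∣-refl }
  search {n} m (suc gap) m+gap≡n 2≤m rough with m ∣? n
  ... | yes m∣n = record { factor = m ; 2≤factor = 2≤m ; rough = rough ; factor∣n = m∣n }
  ... | no m∤n  = search (suc m) gap (trans (sym (+-suc m gap)) m+gap≡n)
                         (m≤n⇒m≤1+n 2≤m) (∤⇒rough-suc m∤n rough)

  leastFactor : ∀ n → 2 ≤ n → LeastFactor n
  leastFactor n 2≤n = search 2 (n ∸ 2) (m+[n∸m]≡n 2≤n) ≤-refl 2-rough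

  proper-divisor⇒¬prime : ∀ {d n} → 2 ≤ d → d < n → d ∣ n → ¬ Prime n
  proper-divisor⇒¬prime 2≤d d<n d∣n =
    composite⇒¬prime (hasNonTrivialDivisor {{n>1⇒nonTrivial 2≤d}} d<n d∣n)

module LowCoefficients where

  open import Data.Nat as ℕ using (ℕ; zero; suc; z≤n; s≤s)
  import Data.Nat.Properties as ℕP
  open import Data.Nat.Divisibility using (_∣_; divides)
  open import Data.Nat.Primality using (Prime)
  open import Data.Integer
    using (ℤ; +_; -[1+_]; 0ℤ; ∣_∣; _+_; _*_; _-_; -_; _≤_; _<_; +<+; _≟_)
  import Data.Integer.Properties as ℤP
  import Data.Integer.Tactic.RingSolver as ℤSolver
  open import Data.List using ([]; _∷_)
  open import Data.Product using (_×_; _,_; proj₁)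
  open import Data.Sum using (_⊎_; inj₁; inj₂)
  open import Data.Empty using (⊥-elim)
  open import Relation.Binary.PropositionalEquality
  open import Relation.Nullary using (¬_; yes; no)
  open IntegerOrder
  open NatInequalities using (factored-bound)
  open LeastFactors

  normCD : ℕ → ℕ → ℤ
  normCD K l = norm (+ 1 ∷ + K ∷ []) + norm (+ l ∷ [])

  lowNorm : ℤ → ℤ → ℤ → ℤ → ℤ
  lowNorm a0 a1 b0 b1 = a0 * a0 + a1 * a1 + (b0 * b0 + b1 * b1)

  Matches : ℕ → ℕ → ℤ → ℤ → ℤ → ℤ → Set
  Matches K l a0 a1 b0 b1 = (a0 * b0 ≡ + l) × (a0 * b1 + a1 * b0 ≡ + K * + l)

  Outcome : ℕ → ℕ → (Q P : ℤ) → Set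
  Outcome K l Q P = normCD K l < Q ⊎ (Q ≡ normCD K l × P ≡ 0ℤ)

  outcome-cong : ∀ {K l Q Q′ P P′} → Q ≡ Q′ → P ≡ P′ → Outcome K l Q P → Outcome K l Q′ P′
  outcome-cong refl refl outcome = outcome

  LeastPrimeBound : ℕ → ℕ → Set
  LeastPrimeBound K l = ¬ Prime l → (p : ℕ) → Prime p → p ∣ l →
    ((q : ℕ) → Prime q → q ∣ l → p ℕ.≤ q) → p ℕ.* p ℕ.* p ℕ.* p ℕ.+ l ℕ.* l ℕ.< K ℕ.* K ℕ.* (p ℕ.* p)

  swap-matches : ∀ {K l} a0 a1 b0 b1 → Matches K l a0 a1 b0 b1 → Matches K l b0 b1 a0 a1
  swap-matches a0 a1 b0 b1 (constant , linear) =
    trans (ℤP.*-comm b0 a0) constant , trans (exchange a0 a1 b0 b1) linear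
    where
    exchange : ∀ a0 a1 b0 b1 → b0 * a1 + b1 * a0 ≡ a0 * b1 + a1 * b0
    exchange = ℤSolver.solve-∀

  swap-lowNorm : ∀ a0 a1 b0 b1 → lowNorm b0 b1 a0 a1 ≡ lowNorm a0 a1 b0 b1
  swap-lowNorm a0 a1 b0 b1 = ℤP.+-comm (b0 * b0 + b1 * b1) (a0 * a0 + a1 * a1)

  negate-matches : ∀ {K l} a0 a1 b0 b1 → Matches K l a0 a1 b0 b1 →
    Matches K l (- a0) (- a1) (- b0) (- b1)
  negate-matches a0 a1 b0 b1 (constant , linear) =
    trans (negate-product a0 b0) constant , trans (negate-linear a0 a1 b0 b1) linear
    where
    negate-product : ∀ a b → - a * - b ≡ a * b
    negate-product = ℤSolver.solve-∀
    negate-linear : ∀ a0 a1 b0 b1 → - a0 * - b1 + - a1 * - b0 ≡ a0 * b1 + a1 * b0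
    negate-linear = ℤSolver.solve-∀

  negate-lowNorm : ∀ a0 a1 b0 b1 → lowNorm (- a0) (- a1) (- b0) (- b1) ≡ lowNorm a0 a1 b0 b1
  negate-lowNorm a0 a1 b0 b1 = expand a0 a1 b0 b1
    where
    expand : ∀ a0 a1 b0 b1 →
      - a0 * - a0 + - a1 * - a1 + (- b0 * - b0 + - b1 * - b1)
        ≡ a0 * a0 + a1 * a1 + (b0 * b0 + b1 * b1)
    expand = ℤSolver.solve-∀

  -- With t = K − x and 2K ≤ l²: (K − t)² + (lt)² = K² + t² + (l² − 2K)t² + 2K·t(t − 1),
  -- which exceeds K² unless t = 0.
  shifted-bound : ∀ K l → 2 ℕ.* K ℕ.≤ l ℕ.* l → ∀ t → ¬ t ≡ 0ℤ →
    + K * + K < (+ K - t) * (+ K - t) + (+ l * t) * (+ l * t)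
  shifted-bound K l 2K≤l² t t≢0 with ℕP.m≤n⇒∃[o]m+o≡n 2K≤l²
  ... | e , 2K+e≡l² =
    subst (+ K * + K <_) (sym expansion)
          (<-+-pos (+ K * + K) (ℤP.<-≤-trans (square-pos t t≢0) (≤-+-nonneg (t * t) slack-nonneg)))
    where
    slack : ℤ
    slack = + e * (t * t) + + 2 * + K * (t * (t - + 1))
    slack-nonneg : 0ℤ ≤ slack
    slack-nonneg = nonneg-+ (nonneg-* (pos-nonneg e) (square-nonneg t))
                            (nonneg-* (nonneg-* (pos-nonneg 2) (pos-nonneg K))
                                      (consecutive-product-nonneg t))
    l²≡2K+e : + l * + l ≡ + 2 * + K + + e
    l²≡2K+e = trans (sym (ℤP.pos-* l l))
                    (trans (cong +_ (sym 2K+e≡l²)) (cong (_+ + e) (ℤP.pos-* 2 K)))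
    factor-square : ∀ K L t → (K - t) * (K - t) + (L * t) * (L * t) ≡ (K - t) * (K - t) + (L * L) * (t * t)
    factor-square = ℤSolver.solve-∀
    complete-square : ∀ K E t →
      (K - t) * (K - t) + (+ 2 * K + E) * (t * t)
        ≡ K * K + (t * t + (E * (t * t) + + 2 * K * (t * (t - + 1))))
    complete-square = ℤSolver.solve-∀
    expansion : (+ K - t) * (+ K - t) + (+ l * t) * (+ l * t) ≡ + K * + K + (t * t + slack)
    expansion = begin
      (+ K - t) * (+ K - t) + (+ l * t) * (+ l * t)      ≡⟨ factor-square (+ K) (+ l) t ⟩
      (+ K - t) * (+ K - t) + (+ l * + l) * (t * t)      ≡⟨ cong (λ L² → (+ K - t) * (+ K - t) + L² * (t * t)) l²≡2K+e ⟩
      (+ K - t) * (+ K - t) + (+ 2 * + K + + e) * (t * t) ≡⟨ complete-square (+ K) (+ e) t ⟩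
      + K * + K + (t * t + slack)                        ∎
      where open ≡-Reasoning

  solve-linear : ∀ K l x y → y + x * + l ≡ + K * + l → + l * (+ K - x) ≡ y
  solve-linear K l x y linear = begin
    + l * (+ K - x)              ≡⟨ distribute (+ K) (+ l) x ⟩
    + K * + l - x * + l          ≡⟨ cong (_- x * + l) linear ⟨
    (y + x * + l) - x * + l      ≡⟨ cancel y (x * + l) ⟩
    y                            ∎
    where
    open ≡-Reasoning
    distribute : ∀ K L x → L * (K - x) ≡ K * L - x * L
    distribute = ℤSolver.solve-∀
    cancel : ∀ y z → (y + z) - z ≡ y
    cancel = ℤSolver.solve-∀

  unit-bound : ∀ K l → 2 ℕ.* K ℕ.≤ l ℕ.* l → ∀ x y → y + x * + l ≡ + K * + l →
    + K * + K < x * x + y * y ⊎ (x ≡ + K × y ≡ 0ℤ)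
  unit-bound K l 2K≤l² x y linear with + K - x ≟ 0ℤ
  ... | yes t≡0 =
    inj₂ (sym (ℤP.i-j≡0⇒i≡j (+ K) x t≡0) ,
          trans (sym (solve-linear K l x y linear)) (trans (cong (+ l *_) t≡0) (ℤP.*-zeroʳ (+ l))))
  ... | no t≢0 =
    inj₁ (subst (+ K * + K <_) (cong₂ (λ a b → a * a + b * b) (shift-back (+ K) x) (solve-linear K l x y linear))
                (shifted-bound K l 2K≤l² (+ K - x) t≢0))
    where
    shift-back : ∀ K x → K - (K - x) ≡ x
    shift-back = ℤSolver.solve-∀

  -- If a₀ = 1 then b₀ = l, and unit-bound applies to (x, y) = (a₁, b₁).
  unit-outcome : ∀ K l → 2 ℕ.* K ℕ.≤ l ℕ.* l → ∀ a1 b0 b1 → Matches K l (+ 1) a1 b0 b1 →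
    Outcome K l (lowNorm (+ 1) a1 b0 b1) (a1 * b1)
  unit-outcome K l 2K≤l² a1 b0 b1 (constant , linear)
    with trans (sym (ℤP.*-identityˡ b0)) constant
  ... | refl with unit-bound K l 2K≤l² a1 b1 (trans (cong (_+ a1 * + l) (sym (ℤP.*-identityˡ b1))) linear)
  ...   | inj₁ K²<x²+y² =
    inj₁ (subst₂ _<_ (sym (split-normCD (+ K) (+ l))) (sym (split-lowNorm a1 b1 (+ l)))
                 (ℤP.+-monoʳ-< (+ 1 + + l * + l) K²<x²+y²))
    where
    split-normCD : ∀ K L → (+ 1 * + 1 + (K * K + + 0)) + (L * L + + 0) ≡ (+ 1 + L * L) + K * K
    split-normCD = ℤSolver.solve-∀
    split-lowNorm : ∀ x y L → + 1 * + 1 + x * x + (L * L + y * y) ≡ (+ 1 + L * L) + (x * x + y * y)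
    split-lowNorm = ℤSolver.solve-∀
  ...   | inj₂ (refl , refl) = inj₂ (same-norm (+ K) (+ l) , ℤP.*-zeroʳ (+ K))
    where
    same-norm : ∀ K L → + 1 * + 1 + K * K + (L * L + + 0 * + 0) ≡ (+ 1 * + 1 + (K * K + + 0)) + (L * L + + 0)
    same-norm = ℤSolver.solve-∀

  IsUnit : ℤ → Set
  IsUnit x = x ≡ + 1 ⊎ x ≡ -[1+ 0 ]

  -- The unit case a₀ = ±1, reducing a₀ = −1 to a₀ = 1 by negating a and b.
  unit-outcome± : ∀ K l {a0} → 2 ℕ.* K ℕ.≤ l ℕ.* l → IsUnit a0 → ∀ a1 b0 b1 →
    Matches K l a0 a1 b0 b1 → Outcome K l (lowNorm a0 a1 b0 b1) (a1 * b1)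
  unit-outcome± K l 2K≤l² (inj₁ refl) a1 b0 b1 matches = unit-outcome K l 2K≤l² a1 b0 b1 matches
  unit-outcome± K l 2K≤l² (inj₂ refl) a1 b0 b1 matches =
    outcome-cong {K} {l} (negate-lowNorm -[1+ 0 ] a1 b0 b1) (negate-product a1 b1)
      (unit-outcome K l 2K≤l² (- a1) (- b0) (- b1) (negate-matches {K} {l} -[1+ 0 ] a1 b0 b1 matches))
    where
    negate-product : ∀ a b → - a * - b ≡ a * b
    negate-product = ℤSolver.solve-∀

  -- Lagrange's identity (a₀b₁ + a₁b₀)² + (a₀a₁ − b₀b₁)² = (a₁² + b₁²)(a₀² + b₀²) gives the
  -- Cauchy–Schwarz inequality, in absolute values.
  cauchy-schwarz : ∀ a0 a1 b0 b1 → let w = ∣ a0 * b1 + a1 * b0 ∣ in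
    w ℕ.* w ℕ.≤ (∣ a1 ∣ ℕ.* ∣ a1 ∣ ℕ.+ ∣ b1 ∣ ℕ.* ∣ b1 ∣) ℕ.* (∣ a0 ∣ ℕ.* ∣ a0 ∣ ℕ.+ ∣ b0 ∣ ℕ.* ∣ b0 ∣)
  cauchy-schwarz a0 a1 b0 b1 = ℕP.≤-trans (ℕP.m≤m+n _ _) (ℕP.≤-reflexive (ℤP.+-injective lagrange-abs))
    where
    w = a0 * b1 + a1 * b0
    D = a0 * a1 - b0 * b1
    lagrange : ∀ a0 a1 b0 b1 →
      (a0 * b1 + a1 * b0) * (a0 * b1 + a1 * b0) + (a0 * a1 - b0 * b1) * (a0 * a1 - b0 * b1)
        ≡ (a1 * a1 + b1 * b1) * (a0 * a0 + b0 * b0)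
    lagrange = ℤSolver.solve-∀
    lagrange-abs : + (∣ w ∣ ℕ.* ∣ w ∣ ℕ.+ ∣ D ∣ ℕ.* ∣ D ∣)
      ≡ + ((∣ a1 ∣ ℕ.* ∣ a1 ∣ ℕ.+ ∣ b1 ∣ ℕ.* ∣ b1 ∣) ℕ.* (∣ a0 ∣ ℕ.* ∣ a0 ∣ ℕ.+ ∣ b0 ∣ ℕ.* ∣ b0 ∣))
    lagrange-abs = begin
      _                                            ≡⟨ sum-of-squares w D ⟨
      w * w + D * D                                ≡⟨ lagrange a0 a1 b0 b1 ⟩
      (a1 * a1 + b1 * b1) * (a0 * a0 + b0 * b0)    ≡⟨ cong₂ _*_ (sum-of-squares a1 b1) (sum-of-squares a0 b0) ⟩
      _                                            ≡⟨ ℤP.pos-* (∣ a1 ∣ ℕ.* ∣ a1 ∣ ℕ.+ ∣ b1 ∣ ℕ.* ∣ b1 ∣) (∣ a0 ∣ ℕ.* ∣ a0 ∣ ℕ.+ ∣ b0 ∣ ℕ.* ∣ b0 ∣) ⟨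
      _                                            ∎
      where open ≡-Reasoning

  -- The non-unit case |a₀|, |b₀| ≥ 2: l = |a₀||b₀| is composite, and factored-bound applies
  -- with p the least prime factor of l and g = a₁² + b₁².
  non-unit : ∀ K l a0 a1 b0 b1 → 5 ℕ.≤ l → LeastPrimeBound K l → 2 ℕ.≤ ∣ a0 ∣ → 2 ℕ.≤ ∣ b0 ∣ →
    Matches K l a0 a1 b0 b1 → normCD K l < lowNorm a0 a1 b0 b1
  non-unit K l a0 a1 b0 b1 5≤l bound 2≤u 2≤v (constant , linear) =
    subst₂ _<_ (sym normCD≡) (sym lowNorm≡)
      (+<+ (factored-bound {K} g uv≡l 2≤u 2≤v 5≤l (below 2≤u u∣l) (below 2≤v v∣l) p-bound cs))
    where
    u = ∣ a0 ∣
    v = ∣ b0 ∣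
    g = ∣ a1 ∣ ℕ.* ∣ a1 ∣ ℕ.+ ∣ b1 ∣ ℕ.* ∣ b1 ∣
    uv≡l : u ℕ.* v ≡ l
    uv≡l = trans (sym (ℤP.abs-* a0 b0)) (cong ∣_∣ constant)
    u∣l : u ∣ l
    u∣l = divides v (trans (sym uv≡l) (ℕP.*-comm u v))
    v∣l : v ∣ l
    v∣l = divides u (sym uv≡l)
    u<l : u ℕ.< l
    u<l = subst (u ℕ.<_) uv≡l (ℕP.m<m*n u v {{ℕ.>-nonZero (ℕP.<-≤-trans (s≤s z≤n) 2≤u)}} 2≤v)
    open LeastFactor (leastFactor l (ℕP.≤-trans (s≤s (s≤s z≤n)) 5≤l))
    p-bound : factor ℕ.* factor ℕ.* factor ℕ.* factor ℕ.+ l ℕ.* l ℕ.< K ℕ.* K ℕ.* (factor ℕ.* factor)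
    p-bound = bound (proper-divisor⇒¬prime 2≤u u<l u∣l) factor prime factor∣n minimal
    cs : (K ℕ.* l) ℕ.* (K ℕ.* l) ℕ.≤ g ℕ.* (u ℕ.* u ℕ.+ v ℕ.* v)
    cs = subst (λ w → w ℕ.* w ℕ.≤ g ℕ.* (u ℕ.* u ℕ.+ v ℕ.* v))
               (trans (cong ∣_∣ linear) (ℤP.abs-* (+ K) (+ l))) (cauchy-schwarz a0 a1 b0 b1)
    regroup-normCD : ∀ K L → (+ 1 * + 1 + (K * K + + 0)) + (L * L + + 0) ≡ + 1 + K * K + L * L
    regroup-normCD = ℤSolver.solve-∀
    normCD≡ : normCD K l ≡ + (1 ℕ.+ K ℕ.* K ℕ.+ l ℕ.* l)
    normCD≡ = trans (regroup-normCD (+ K) (+ l))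
                    (cong₂ (λ K² l² → + 1 + K² + l²) (sym (ℤP.pos-* K K)) (sym (ℤP.pos-* l l)))
    regroup-lowNorm : ∀ a0 a1 b0 b1 →
      a0 * a0 + a1 * a1 + (b0 * b0 + b1 * b1) ≡ (a1 * a1 + b1 * b1) + (a0 * a0 + b0 * b0)
    regroup-lowNorm = ℤSolver.solve-∀
    lowNorm≡ : lowNorm a0 a1 b0 b1 ≡ + (g ℕ.+ (u ℕ.* u ℕ.+ v ℕ.* v))
    lowNorm≡ = trans (regroup-lowNorm a0 a1 b0 b1)
                     (cong₂ _+_ (sum-of-squares a1 b1) (sum-of-squares a0 b0))

  data Shape : ℤ → Set where
    vanishing : Shape 0ℤ
    unit      : ∀ {x} → IsUnit x → Shape x
    large     : ∀ {x} → 2 ℕ.≤ ∣ x ∣ → Shape x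

  shape : ∀ x → Shape x
  shape (+ zero)        = vanishing
  shape (+ suc zero)    = unit (inj₁ refl)
  shape (+ suc (suc n)) = large (s≤s (s≤s z≤n))
  shape -[1+ zero ]     = unit (inj₂ refl)
  shape -[1+ suc n ]    = large (s≤s (s≤s z≤n))

  no-zero-constant : ∀ {l} → 5 ℕ.≤ l → ¬ 0ℤ ≡ + l
  no-zero-constant (s≤s _) ()

  low-coefficients : ∀ K l a0 a1 b0 b1 → 5 ℕ.≤ l → 2 ℕ.* K ℕ.≤ l ℕ.* l → LeastPrimeBound K l →
    Matches K l a0 a1 b0 b1 → Outcome K l (lowNorm a0 a1 b0 b1) (a1 * b1)
  low-coefficients K l a0 a1 b0 b1 5≤l 2K≤l² bound matches with shape a0 | shape b0
  ... | vanishing | _     =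
    ⊥-elim (no-zero-constant 5≤l (trans (sym (ℤP.*-zeroˡ b0)) (proj₁ matches)))
  ... | _       | vanishing =
    ⊥-elim (no-zero-constant 5≤l (trans (sym (ℤP.*-zeroʳ a0)) (proj₁ matches)))
  ... | unit a0-unit | _  = unit-outcome± K l 2K≤l² a0-unit a1 b0 b1 matches
  ... | large _ | unit b0-unit =
    outcome-cong {K} {l} (swap-lowNorm a0 a1 b0 b1) (ℤP.*-comm b1 a1)
      (unit-outcome± K l 2K≤l² b0-unit b1 a0 a1 (swap-matches {K} {l} a0 a1 b0 b1 matches))
  ... | large 2≤u | large 2≤v = inj₁ (non-unit K l a0 a1 b0 b1 5≤l bound 2≤u 2≤v matches)

  norm-split : ∀ a0 a1 A b0 b1 B →
    norm (a0 ∷ a1 ∷ A) + norm (b0 ∷ b1 ∷ B) ≡ lowNorm a0 a1 b0 b1 + (norm A + norm B)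
  norm-split a0 a1 A b0 b1 B = regroup a0 a1 b0 b1 (norm A) (norm B)
    where
    regroup : ∀ a0 a1 b0 b1 nA nB →
      (a0 * a0 + (a1 * a1 + nA)) + (b0 * b0 + (b1 * b1 + nB))
        ≡ (a0 * a0 + a1 * a1 + (b0 * b0 + b1 * b1)) + (nA + nB)
    regroup = ℤSolver.solve-∀

  constant-pair≤normCD : ∀ K l → norm (+ 1 ∷ []) + norm (+ l ∷ []) ≤ normCD K l
  constant-pair≤normCD K l =
    subst (norm (+ 1 ∷ []) + norm (+ l ∷ []) ≤_) (sym (regroup (+ K) (+ l)))
          (≤-+-nonneg _ (square-nonneg (+ K)))
    where
    regroup : ∀ K L →
      (+ 1 * + 1 + (K * K + + 0)) + (L * L + + 0) ≡ ((+ 1 * + 1 + + 0) + (L * L + + 0)) + K * K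
    regroup = ℤSolver.solve-∀

open import Data.Nat using (ℕ; zero; suc; _<_; _≤_; _*_; _+_; z≤n; s≤s)
import Data.Nat.Properties as ℕP
open import Data.Nat.Divisibility using (_∣_)
open import Data.Nat.Primality using (Prime; prime?)
open import Data.Integer using (ℤ; +_; 0ℤ; +<+)
import Data.Integer as ℤ
import Data.Integer.Properties as ℤP
open import Data.List using (_∷_; [])
open import Data.Vec using (_∷_; []; toList)
open import Data.Product using (_×_; _,_; ∃; proj₁; proj₂)
open import Data.Sum using (_⊎_; inj₁; inj₂)
open import Relation.Binary.PropositionalEquality
open import Relation.Nullary using (¬_; yes; no)
open IntegerOrder
open Polynomials
open LeastFactors
open LowCoefficients

truncation-matches : ∀ K l m a0 a1 A b0 b1 B →
  trunc (suc (suc m)) ((a0 ∷ a1 ∷ A) *ₚ (b0 ∷ b1 ∷ B))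
    ≈ₚ trunc (suc (suc m)) ((+ 1 ∷ + K ∷ []) *ₚ (+ l ∷ [])) →
  Matches K l a0 a1 b0 b1
truncation-matches K l m a0 a1 A b0 b1 B H =
  trans (sym (ℤP.+-identityʳ _)) (trans (H 0) (trans (ℤP.+-identityʳ _) (ℤP.*-identityˡ (+ l)))) ,
  trans (cong (λ z → a0 ℤ.* b1 ℤ.+ z) (sym (ℤP.+-identityʳ _))) (trans (H 1) (ℤP.+-identityʳ _))

product-equal : ∀ K l a0 a1 A b0 b1 B → Matches K l a0 a1 b0 b1 → a1 ℤ.* b1 ≡ 0ℤ →
  IsZero A → IsZero B → ((a0 ∷ a1 ∷ A) *ₚ (b0 ∷ b1 ∷ B)) ≈ₚ ((+ 1 ∷ + K ∷ []) *ₚ (+ l ∷ []))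
product-equal K l a0 a1 A b0 b1 B (constant , linear) a1b1≡0 A≡0 B≡0 zero =
  cong (ℤ._+ 0ℤ) (trans constant (sym (ℤP.*-identityˡ (+ l))))
product-equal K l a0 a1 A b0 b1 B (constant , linear) a1b1≡0 A≡0 B≡0 (suc zero) =
  trans (cong (λ z → a0 ℤ.* b1 ℤ.+ z) (ℤP.+-identityʳ _)) (trans linear (sym (ℤP.+-identityʳ _)))
product-equal K l a0 a1 A b0 b1 B (constant , linear) a1b1≡0 A≡0 B≡0 (suc (suc j)) =
  trans (coeff-beyond-linear a0 a1 A b0 b1 B A≡0 B≡0 j) (vanishes j)
  where
  vanishes : ∀ j → coeff (a1 ℤ.* b1 ∷ []) j ≡ 0ℤ
  vanishes zero    = a1b1≡0
  vanishes (suc j) = refl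

add-tails : ∀ K l a0 a1 A b0 b1 B → Matches K l a0 a1 b0 b1 →
  Outcome K l (lowNorm a0 a1 b0 b1) (a1 ℤ.* b1) →
  ((a0 ∷ a1 ∷ A) *ₚ (b0 ∷ b1 ∷ B)) ≈ₚ ((+ 1 ∷ + K ∷ []) *ₚ (+ l ∷ []))
    ⊎ normCD K l ℤ.< norm (a0 ∷ a1 ∷ A) ℤ.+ norm (b0 ∷ b1 ∷ B)
add-tails K l a0 a1 A b0 b1 B matches (inj₁ N<Q) =
  inj₂ (subst (normCD K l ℤ.<_) (sym (norm-split a0 a1 A b0 b1 B))
              (ℤP.<-≤-trans N<Q (≤-+-nonneg _ (nonneg-+ (norm-nonneg A) (norm-nonneg B)))))
add-tails K l a0 a1 A b0 b1 B matches (inj₂ (Q≡N , a1b1≡0)) with tails-zero-or-pos A B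
... | inj₁ (A≡0 , B≡0) = inj₁ (product-equal K l a0 a1 A b0 b1 B matches a1b1≡0 A≡0 B≡0)
... | inj₂ tails>0     =
  inj₂ (subst (normCD K l ℤ.<_) (sym (norm-split a0 a1 A b0 b1 B))
              (subst (ℤ._< _) Q≡N (<-+-pos (lowNorm a0 a1 b0 b1) tails>0)))

threshold-one : ∀ K l → 5 ≤ l → 2 * K ≤ l * l → LeastPrimeBound K l →
  Threshold (+ 1 ∷ + K ∷ []) (+ l ∷ []) 1
threshold-one K l 5≤l 2K≤l² bound zero          ()
threshold-one K l 5≤l 2K≤l² bound (suc zero)    (s≤s ())
threshold-one K l 5≤l 2K≤l² bound (suc (suc m)) _ (a0 ∷ a1 ∷ as) (b0 ∷ b1 ∷ bs) H =
  add-tails K l a0 a1 (toList as) b0 b1 (toList bs) matches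
            (low-coefficients K l a0 a1 b0 b1 5≤l 2K≤l² bound matches)
  where
  matches : Matches K l a0 a1 b0 b1
  matches = truncation-matches K l m a0 a1 (toList as) b0 b1 (toList bs) H

zero-not-threshold : ∀ K l → 0 < l → ¬ Threshold (+ 1 ∷ + suc K ∷ []) (+ l ∷ []) 0
zero-not-threshold K (suc l) _ threshold
  with threshold 1 (s≤s z≤n) (+ 1 ∷ []) (+ suc l ∷ []) (λ { zero → refl ; (suc n) → refl })
... | inj₁ ab≈cd with ab≈cd 1
...   | ()
zero-not-threshold K (suc l) _ threshold | inj₂ too-large =
  ℤP.<⇒≱ too-large (constant-pair≤normCD (suc K) (suc l))

positive⇒suc : ∀ {k} → 0ℤ ℤ.< k → ∃ λ K → k ≡ + suc K
positive⇒suc (+<+ {n = suc K} _) = K , refl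

positive-coefficient : ∀ {P : ℕ → Set} l k → 2 ≤ l → (Prime l → + 1 ℤ.≤ k) →
  (¬ Prime l → (p : ℕ) → Prime p → p ∣ l → ((q : ℕ) → Prime q → q ∣ l → p ≤ q) → + 0 ℤ.< k × P p) →
  ∃ λ K → k ≡ + suc K
positive-coefficient l k 2≤l prime-case composite-case with prime? l
... | yes l-prime = positive⇒suc (ℤP.<-≤-trans (+<+ (s≤s z≤n)) (prime-case l-prime))
... | no l-composite = positive⇒suc (proj₁ (composite-case l-composite factor prime factor∣n minimal))
  where open LeastFactor (leastFactor l 2≤l)

lemma5p2 : (l : ℕ) (k : ℤ) → 5 ≤ l →
    (Prime l → + 1 Data.Integer.≤ k) →
    (¬ Prime l → (p : ℕ) → Prime p → p ∣ l → ((q : ℕ) → Prime q → q ∣ l → p ≤ q) →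
    (+ 0 Data.Integer.< k) × ((+ (p * p * p * p + l * l)) Data.Integer.< k Data.Integer.* k Data.Integer.* + (p * p))) →
    + 2 Data.Integer.* k Data.Integer.≤ + (l * l) →
    IsM0 (+ 1 ∷ k ∷ []) (+ l ∷ []) 1
lemma5p2 l k 5≤l prime-case composite-case 2k≤l²
  with positive-coefficient l k (ℕP.≤-trans (s≤s (s≤s z≤n)) 5≤l) prime-case composite-case
... | K , refl = threshold-one (suc K) l 5≤l (ℤP.drop‿+≤+ 2k≤l²) bound , not-below-one
  where
  bound : LeastPrimeBound (suc K) l
  bound l-composite p p-prime p∣l p-least =
    ℤP.drop‿+<+ (subst (+ (p * p * p * p + l * l) ℤ.<_) (sym (ℤP.pos-* (suc K * suc K) (p * p)))
                       (proj₂ (composite-case l-composite p p-prime p∣l p-least)))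
  not-below-one : ∀ n → n < 1 → ¬ Threshold (+ 1 ∷ + suc K ∷ []) (+ l ∷ []) n
  not-below-one zero _ = zero-not-threshold K l (ℕP.≤-trans (s≤s z≤n) 5≤l)
  not-below-one (suc n) (s≤s ())
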